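{- Let $k,N\in\mathbb{N}$ and let $f:[k]\to\mathrm{Tree}(N)$ be a $0.001$-distorted embedding with rescaling $r\in[N]$, i.e. $r|i-j|\le d_T(f(i),f(j))\le1.001\,r|i-j|$ for all $i,j\in[k]$. Let $\gamma\subset\mathrm{Tree}(N)$ be the geodesic from $f(1)$ to $f(k)$. Then $d_T(f(i),\gamma):=\min_{w\in\gamma}d_T(f(i),w)\le0.01\,r$ for all $i\in[k]$.
   Context: $\mathrm{Tree}(N)$ is the complete binary tree of depth $N$ (vertices are binary strings of length $0,\dots,N-1$, each string $w$ adjacent to $w0$ and $w1$), and $d_T$ is its shortest-path metric. The geodesic between two vertices is the unique shortest path between them, viewed as a set of vertices. $[k]=\{1,\dots,k\}$. -}

module Defs where

open import Data.Nat using (ℕ; zero; suc; _<_; _≤_)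
open import Data.Bool using (Bool)
open import Data.List using (List; []; _∷_; _++_; length)
open import Data.Product using (Σ; ∃; _×_; _,_; proj₁)
open import Data.Sum using (_⊎_)
open import Relation.Binary.PropositionalEquality using (_≡_)

Vertex : ℕ → Set
Vertex N = Σ (List Bool) (λ w → length w < N)

Adj : ∀ {N} → Vertex N → Vertex N → Set
Adj (u , _) (v , _) = (∃ λ b → v ≡ u ++ b ∷ []) ⊎ (∃ λ b → u ≡ v ++ b ∷ [])

data Walk {N : ℕ} : Vertex N → Vertex N → ℕ → Set where
  here : ∀ {u} → Walk u u zero
  step : ∀ {u w v n} → Adj u w → Walk w v n → Walk u v (suc n)

data OnWalk {N : ℕ} (x : Vertex N) : ∀ {u v n} → Walk u v n → Set where
  start : ∀ {u v n} {p : Walk {N} u v n} → x ≡ u → OnWalk {N} x p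
  later : ∀ {u w v n} {a : Adj {N} u w} {p : Walk {N} w v n} → OnWalk x p → OnWalk x (step {N} {u} {w} a p)

Dist : ∀ {N} → Vertex N → Vertex N → ℕ → Set
Dist u v d = Walk u v d × (∀ {m} → Walk u v m → d ≤ m)

OnGeodesic : ∀ {N} → Vertex N → Vertex N → Vertex N → Set
OnGeodesic u v x = Σ ℕ λ d → Σ (Walk u v d) λ p → (∀ {m} → Walk u v m → d ≤ m) × OnWalk x p

module Submission where

open import Defs
open import Data.Nat using (ℕ; suc; _≤_; _*_; ∣_-_∣)
open import Data.Fin using (Fin; toℕ; fromℕ)
open import Data.Product using (Σ; _×_)

open import Data.Bool using (Bool; true; false; not)
open import Data.Fin using (zero; suc)
open import Data.Fin.Properties using (toℕ-fromℕ; toℕ≤pred[n])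
open import Data.List using (List; []; _∷_; _++_; length)
open import Data.Nat using (zero; _+_; _∸_; _<_; _⊔_; z≤n; s≤s; s≤s⁻¹; _≤?_; NonZero; >-nonZero)
open import Data.Nat.Properties
open import Algebra.Properties.CommutativeSemigroup +-commutativeSemigroup
  using (xy∙z≈x∙zy; x∙yz≈yx∙z; interchange)
open import Data.Nat.Tactic.RingSolver using (solve; solve-∀)
open import Data.Product using (∃; ∃-syntax; _,_; proj₁; proj₂)
import Data.Product as Product
open import Data.Sum using (_⊎_; inj₁; inj₂; reduce; swap)
import Data.Sum as Sum
open import Function using (_∘_; _$_)
open import Function.Metric.Nat using (DistanceFunction; Symmetric; TriangleInequality)
open import Relation.Binary.PropositionalEquality
open import Relation.Nullary using (¬_; yes; no; contradiction)
open import Relation.Nullary.Decidable using (¬?; decidable-stable)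
open import Relation.Unary using (Pred; Decidable)

-- Let x = f(i), a = f(1), b = f(k), and let (p|q)ₓ be the Gromov product at x.  The median of
-- x, a, b lies on the geodesic [a, b] at distance (a|b)ₓ from x, so it suffices to bound (a|b)ₓ.
-- A tree is 0-hyperbolic: (p|q)ₓ ≥ min ((p|s)ₓ, (s|q)ₓ).  Call c beyond if (a|c)ₓ ≥ (a|b)ₓ; then a
-- and b are beyond, and if x is, (a|b)ₓ = 0.  Otherwise a discrete intermediate-value search
-- finds m < i ≤ M with u = f(m), v = f(M+1) beyond and their neighbours y = f(m+1), z = f(M) not.
-- Ultrametricity gives (u|v)ₓ ≥ (a|b)ₓ and d(y,z) ≤ d(y,u) + d(z,v) ≤ 2.002 r, which forces
-- M - m ≤ 3; hence 2 (a|b)ₓ ≤ d(x,u) + d(x,v) - d(u,v) ≤ 0.001 r (M + 1 - m) ≤ 0.004 r.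

crossing : ∀ {p} {P : Pred ℕ p} → Decidable P → ∀ {m n} → m ≤ n → P m → ¬ P n
         → ∃[ j ] m ≤ j × j < n × P j × ¬ P (suc j)
crossing P? m≤n pm ¬pn with m≤n⇒m<n∨m≡n m≤n
... | inj₂ refl = contradiction pm ¬pn
crossing P? {n = suc n} _ pm ¬pn | inj₁ (s≤s m≤n) with P? n
... | yes pn = n , m≤n , ≤-refl , pn , ¬pn
... | no ¬pn′ =
  let j , m≤j , j<n , pj , ¬pj′ = crossing P? m≤n pm ¬pn′ in j , m≤j , m<n⇒m<1+n j<n , pj , ¬pj′

clamp : ∀ k → ℕ → Fin (suc k)
clamp k zero = zero
clamp zero (suc n) = zero
clamp (suc k) (suc n) = suc (clamp k n)

toℕ-clamp : ∀ k {n} → n ≤ k → toℕ (clamp k n) ≡ n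
toℕ-clamp k {zero} _ = refl
toℕ-clamp (suc k) {suc n} (s≤s n≤k) = cong suc (toℕ-clamp k n≤k)

clamp-toℕ : ∀ k (i : Fin (suc k)) → clamp k (toℕ i) ≡ i
clamp-toℕ k zero = refl
clamp-toℕ (suc k) (suc i) = cong suc (clamp-toℕ k i)

clamp-fromℕ : ∀ k → clamp k k ≡ fromℕ k
clamp-fromℕ k = trans (cong (clamp k) (sym (toℕ-fromℕ k))) (clamp-toℕ k (fromℕ k))

short-gap : ∀ r s e₁ e₂ .{{_ : NonZero r}} → r * s ≤ e₁ + e₂
          → 1000 * e₁ ≤ 1001 * r → 1000 * e₂ ≤ 1001 * r → s ≤ 2
short-gap r s e₁ e₂ rs≤e e₁≤ e₂≤ =
  s≤s⁻¹ (*-cancelˡ-< 1000 s 3 (≤-<-trans 1000s≤2002 (m≤m+n 2003 997)))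
  where
  1000s≤2002 : 1000 * s ≤ 2002
  1000s≤2002 = *-cancelʳ-≤ (1000 * s) 2002 r (begin
    1000 * s * r          ≡⟨ solve (s ∷ r ∷ []) ⟩
    1000 * (r * s)        ≤⟨ *-monoʳ-≤ 1000 rs≤e ⟩
    1000 * (e₁ + e₂)      ≡⟨ *-distribˡ-+ 1000 e₁ e₂ ⟩
    1000 * e₁ + 1000 * e₂ ≤⟨ +-mono-≤ e₁≤ e₂≤ ⟩
    1001 * r + 1001 * r   ≡⟨ solve (r ∷ []) ⟩
    2002 * r              ∎)
    where open ≤-Reasoning

excess-bound : ∀ r p q e uv xu xv → e + uv ≤ xu + xv → r * (p + q) ≤ uv
             → 1000 * xu ≤ 1001 * (r * p) → 1000 * xv ≤ 1001 * (r * q) → 1000 * e ≤ r * (p + q)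
excess-bound r p q e uv xu xv e+uv≤ rpq≤uv xu≤ xv≤ =
  +-cancelʳ-≤ (1000 * (r * (p + q))) (1000 * e) (r * (p + q)) (begin
    1000 * e + 1000 * (r * (p + q))    ≤⟨ +-monoʳ-≤ (1000 * e) (*-monoʳ-≤ 1000 rpq≤uv) ⟩
    1000 * e + 1000 * uv               ≡⟨ *-distribˡ-+ 1000 e uv ⟨
    1000 * (e + uv)                    ≤⟨ *-monoʳ-≤ 1000 e+uv≤ ⟩
    1000 * (xu + xv)                   ≡⟨ *-distribˡ-+ 1000 xu xv ⟩
    1000 * xu + 1000 * xv              ≤⟨ +-mono-≤ xu≤ xv≤ ⟩
    1001 * (r * p) + 1001 * (r * q)    ≡⟨ solve (r ∷ p ∷ q ∷ []) ⟩
    r * (p + q) + 1000 * (r * (p + q)) ∎)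
  where open ≤-Reasoning

loosen-bound : ∀ D r → 1000 * (D + D) ≤ 4 * r → 100 * D ≤ r
loosen-bound D r h = *-cancelˡ-≤ 20 (begin
  20 * (100 * D) ≡⟨ solve (D ∷ []) ⟩
  1000 * (D + D) ≤⟨ h ⟩
  4 * r          ≤⟨ *-monoˡ-≤ r (m≤m+n 4 16) ⟩
  20 * r         ∎)
  where open ≤-Reasoning

-- Zero-hyperbolic metrics

FourPointCondition : ∀ {A : Set} → DistanceFunction A → Set
FourPointCondition d = ∀ x y z w → d x y + d z w ≤ d x z + d y w ⊎ d x y + d z w ≤ d x w + d y z

cross-sum : ∀ {A B C D E F : ℕ} → C ≤ A ⊎ F ≤ A → E ≤ A ⊎ D ≤ A → C ≤ B ⊎ E ≤ B → F ≤ B ⊎ D ≤ B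
          → C + D ≤ A + B ⊎ E + F ≤ A + B
cross-sum (inj₁ C≤A) _ _ (inj₂ D≤B) = inj₁ (+-mono-≤ C≤A D≤B)
cross-sum (inj₁ C≤A) (inj₁ E≤A) _ (inj₁ F≤B) = inj₂ (+-mono-≤ E≤A F≤B)
cross-sum {A} {B} {C} {D} (inj₁ C≤A) (inj₂ D≤A) (inj₁ C≤B) (inj₁ F≤B) =
  inj₁ (subst (C + D ≤_) (+-comm B A) (+-mono-≤ C≤B D≤A))
cross-sum {A} {B} (inj₁ C≤A) (inj₂ D≤A) (inj₂ E≤B) (inj₁ F≤B) with ≤-total A B
... | inj₁ A≤B = inj₁ (+-mono-≤ C≤A (≤-trans D≤A A≤B))
... | inj₂ B≤A = inj₂ (+-mono-≤ (≤-trans E≤B B≤A) F≤B)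
cross-sum {A} {B} {E = E} {F} (inj₂ F≤A) _ (inj₂ E≤B) _ =
  inj₂ (subst (E + F ≤_) (+-comm B A) (+-mono-≤ E≤B F≤A))
cross-sum {A} {B} {C} {D} (inj₂ F≤A) (inj₂ D≤A) (inj₁ C≤B) _ =
  inj₁ (subst (C + D ≤_) (+-comm B A) (+-mono-≤ C≤B D≤A))
cross-sum (inj₂ F≤A) (inj₁ E≤A) (inj₁ C≤B) (inj₁ F≤B) = inj₂ (+-mono-≤ E≤A F≤B)
cross-sum {A} {B} (inj₂ F≤A) (inj₁ E≤A) (inj₁ C≤B) (inj₂ D≤B) with ≤-total A B
... | inj₁ A≤B = inj₂ (+-mono-≤ E≤A (≤-trans F≤A A≤B))
... | inj₂ B≤A = inj₁ (+-mono-≤ (≤-trans C≤B B≤A) D≤B)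

-- Think of h u = d(o, u) and g u v = (u|v)ₒ for a base point o: if the Gromov product at a single
-- base point is ultrametric, the four-point condition holds.
four-point-from-root : ∀ {A : Set} (d : DistanceFunction A) (h : A → ℕ) (g : A → A → ℕ)
  → (∀ u v → d u v + (g u v + g u v) ≡ h u + h v) → (∀ u v → g u v ≡ g v u)
  → (∀ u v w → g u v ≤ g u w ⊎ g v w ≤ g u w) → FourPointCondition d
four-point-from-root d h g d+2g≡h+h g-comm g-ultra x y z w =
  Sum.map (trade (trans (pairing x y z w)
                        (trans (interchange (h x) (h y) (h z) (h w)) (sym (pairing x z y w)))))
          (trade (trans (pairing x y z w) (trans regroup-heights (sym (pairing x w y z)))))
          (cross-sum (Sum.map₂ (≤-trans (≤-reflexive (g-comm y z))) (g-ultra x z y))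
                     (Sum.map₂ (≤-trans (≤-reflexive (g-comm y w))) (g-ultra x w y))
                     (Sum.map₁ (≤-trans (≤-reflexive (g-comm x z))) (g-ultra z x w))
                     (Sum.map₁ (≤-trans (≤-reflexive (g-comm y z))) (g-ultra z y w)))
  where
  regroup : ∀ a b c e → a + b + ((c + e) + (c + e)) ≡ a + (c + c) + (b + (e + e))
  regroup = solve-∀
  pairing : ∀ p q s t → d p q + d s t + ((g p q + g s t) + (g p q + g s t)) ≡ h p + h q + (h s + h t)
  pairing p q s t =
    trans (regroup (d p q) (d s t) (g p q) (g s t)) (cong₂ _+_ (d+2g≡h+h p q) (d+2g≡h+h s t))
  regroup-heights : h x + h y + (h z + h w) ≡ h x + h w + (h y + h z)
  regroup-heights = trans (cong (h x + h y +_) (+-comm (h z) (h w))) (interchange (h x) (h y) (h w) (h z))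
  trade : ∀ {m n a b} → m + (a + a) ≡ n + (b + b) → b ≤ a → m ≤ n
  trade {m} {n} {a} {b} e b≤a = +-cancelʳ-≤ (a + a) m n (begin
    m + (a + a) ≡⟨ e ⟩
    n + (b + b) ≤⟨ +-monoʳ-≤ n (+-mono-≤ b≤a b≤a) ⟩
    n + (a + a) ∎)
    where open ≤-Reasoning

module ZeroHyperbolic {A : Set} (d : DistanceFunction A) (d-sym : Symmetric d)
  (d-self : ∀ x → d x x ≡ 0) (four-point : FourPointCondition d) where

  triangle : TriangleInequality d
  triangle x y z = begin
    d x z         ≡⟨ +-identityʳ (d x z) ⟨
    d x z + 0     ≡⟨ cong (d x z +_) (d-self y) ⟨
    d x z + d y y ≤⟨ reduce (four-point x z y y) ⟩
    d x y + d z y ≡⟨ cong (d x y +_) (d-sym z y) ⟩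
    d x y + d y z ∎
    where open ≤-Reasoning

  -- Twice the Gromov product (p|q)ₓ; by the triangle inequality the subtraction never truncates.
  ⟨_∣_⟩[_] : A → A → A → ℕ
  ⟨ p ∣ q ⟩[ x ] = d x p + d x q ∸ d p q

  module _ (x : A) where

    gromov-spec : ∀ p q → ⟨ p ∣ q ⟩[ x ] + d p q ≡ d x p + d x q
    gromov-spec p q = m∸n+n≡m (begin
      d p q         ≤⟨ triangle p x q ⟩
      d p x + d x q ≡⟨ cong (_+ d x q) (d-sym p x) ⟩
      d x p + d x q ∎)
      where open ≤-Reasoning

    gromov-comm : ∀ p q → ⟨ p ∣ q ⟩[ x ] ≡ ⟨ q ∣ p ⟩[ x ]
    gromov-comm p q = cong₂ _∸_ (+-comm (d x p) (d x q)) (d-sym p q)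

    gromov-base : ∀ p → ⟨ p ∣ x ⟩[ x ] ≡ 0
    gromov-base p = begin
      d x p + d x x ∸ d p x ≡⟨ cong₂ (λ e f → d x p + e ∸ f) (d-self x) (d-sym p x) ⟩
      d x p + 0 ∸ d x p     ≡⟨ cong (_∸ d x p) (+-identityʳ (d x p)) ⟩
      d x p ∸ d x p         ≡⟨ n∸n≡0 (d x p) ⟩
      0                     ∎
      where open ≡-Reasoning

    gromov-≤ : ∀ {p q s} → d x q + d p s ≤ d x s + d p q → ⟨ p ∣ q ⟩[ x ] ≤ ⟨ p ∣ s ⟩[ x ]
    gromov-≤ {p} {q} {s} h = +-cancelʳ-≤ (d p q + d p s) _ _ (begin
      ⟨ p ∣ q ⟩[ x ] + (d p q + d p s) ≡⟨ +-assoc _ (d p q) (d p s) ⟨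
      ⟨ p ∣ q ⟩[ x ] + d p q + d p s   ≡⟨ cong (_+ d p s) (gromov-spec p q) ⟩
      d x p + d x q + d p s            ≡⟨ +-assoc (d x p) (d x q) (d p s) ⟩
      d x p + (d x q + d p s)          ≤⟨ +-monoʳ-≤ (d x p) h ⟩
      d x p + (d x s + d p q)          ≡⟨ +-assoc (d x p) (d x s) (d p q) ⟨
      d x p + d x s + d p q            ≡⟨ cong (_+ d p q) (gromov-spec p s) ⟨
      ⟨ p ∣ s ⟩[ x ] + d p s + d p q   ≡⟨ xy∙z≈x∙zy _ (d p s) (d p q) ⟩
      ⟨ p ∣ s ⟩[ x ] + (d p q + d p s) ∎)
      where open ≤-Reasoning

    gromov-ultra : ∀ p q s → ⟨ p ∣ s ⟩[ x ] ≤ ⟨ p ∣ q ⟩[ x ] ⊎ ⟨ s ∣ q ⟩[ x ] ≤ ⟨ p ∣ q ⟩[ x ]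
    gromov-ultra p q s with four-point p q x s
    ... | inj₁ pq+xs≤px+qs = inj₂ (subst₂ _≤_ (gromov-comm q s) (gromov-comm q p) (gromov-≤ (begin
      d x s + d q p ≡⟨ cong (d x s +_) (d-sym q p) ⟩
      d x s + d p q ≡⟨ +-comm (d x s) (d p q) ⟩
      d p q + d x s ≤⟨ pq+xs≤px+qs ⟩
      d p x + d q s ≡⟨ cong (_+ d q s) (d-sym p x) ⟩
      d x p + d q s ∎)))
      where open ≤-Reasoning
    ... | inj₂ pq+xs≤ps+qx = inj₁ (gromov-≤ (begin
      d x s + d p q ≡⟨ +-comm (d x s) (d p q) ⟩
      d p q + d x s ≤⟨ pq+xs≤ps+qx ⟩
      d p s + d q x ≡⟨ +-comm (d p s) (d q x) ⟩
      d q x + d p s ≡⟨ cong (_+ d p s) (d-sym q x) ⟩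
      d x q + d p s ∎))
      where open ≤-Reasoning

    gromov-detour : ∀ {y z u v} → ⟨ y ∣ u ⟩[ x ] + ⟨ z ∣ v ⟩[ x ] ≤ ⟨ y ∣ z ⟩[ x ] + (d x u + d x v)
                  → d y z ≤ d y u + d z v
    gromov-detour {y} {z} {u} {v} h = +-cancelʳ-≤ (⟨ y ∣ u ⟩[ x ] + ⟨ z ∣ v ⟩[ x ]) _ _ (begin
      d y z + (⟨ y ∣ u ⟩[ x ] + ⟨ z ∣ v ⟩[ x ])         ≤⟨ +-monoʳ-≤ (d y z) h ⟩
      d y z + (⟨ y ∣ z ⟩[ x ] + (d x u + d x v))       ≡⟨ +-assoc (d y z) (⟨ y ∣ z ⟩[ x ]) _ ⟨
      d y z + ⟨ y ∣ z ⟩[ x ] + (d x u + d x v)         ≡⟨ cong (_+ (d x u + d x v)) yz+⟨yz⟩ ⟩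
      d x y + d x z + (d x u + d x v)                  ≡⟨ interchange (d x y) (d x z) (d x u) (d x v) ⟩
      d x y + d x u + (d x z + d x v)                  ≡⟨ cong₂ _+_ (gromov-spec y u) (gromov-spec z v) ⟨
      ⟨ y ∣ u ⟩[ x ] + d y u + (⟨ z ∣ v ⟩[ x ] + d z v) ≡⟨ interchange (⟨ y ∣ u ⟩[ x ]) (d y u) _ (d z v) ⟩
      ⟨ y ∣ u ⟩[ x ] + ⟨ z ∣ v ⟩[ x ] + (d y u + d z v) ≡⟨ +-comm (⟨ y ∣ u ⟩[ x ] + ⟨ z ∣ v ⟩[ x ]) _ ⟩
      d y u + d z v + (⟨ y ∣ u ⟩[ x ] + ⟨ z ∣ v ⟩[ x ]) ∎)
      where
      open ≤-Reasoning
      yz+⟨yz⟩ : d y z + ⟨ y ∣ z ⟩[ x ] ≡ d x y + d x z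
      yz+⟨yz⟩ = trans (+-comm (d y z) (⟨ y ∣ z ⟩[ x ])) (gromov-spec y z)

  Between : A → A → A → Set
  Between a b p = d a p + d p b ≡ d a b

  record IsMedian (x a b p : A) : Set where
    constructor median-of
    field
      x-p-a : Between x a p
      x-p-b : Between x b p
      a-p-b : Between a b p

  between-sym : ∀ a b p → Between a b p → Between b a p
  between-sym a b p a-p-b = begin
    d b p + d p a ≡⟨ +-comm (d b p) (d p a) ⟩
    d p a + d b p ≡⟨ cong₂ _+_ (d-sym p a) (d-sym b p) ⟩
    d a p + d p b ≡⟨ a-p-b ⟩
    d a b         ≡⟨ d-sym a b ⟩
    d b a         ∎
    where open ≡-Reasoning

  median-swap₁₂ : ∀ {x a b p} → IsMedian x a b p → IsMedian a x b p
  median-swap₁₂ {x} {a} {b} {p} (median-of x-p-a x-p-b a-p-b) =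
    median-of (between-sym x a p x-p-a) a-p-b x-p-b

  median-swap₂₃ : ∀ {x a b p} → IsMedian x a b p → IsMedian x b a p
  median-swap₂₃ {x} {a} {b} {p} (median-of x-p-a x-p-b a-p-b) =
    median-of x-p-b x-p-a (between-sym a b p a-p-b)

  between-≤ : ∀ o {a b p} → Between a b p → d o p ≤ d o a ⊔ d o b
  between-≤ o {a} {b} {p} a-p-b with four-point o p a b
  ... | inj₁ op+ab≤oa+pb = m≤n⇒m≤n⊔o (d o b) (+-cancelʳ-≤ (d p b) (d o p) (d o a) (begin
    d o p + d p b           ≤⟨ +-monoʳ-≤ (d o p) (m≤n+m (d p b) (d a p)) ⟩
    d o p + (d a p + d p b) ≡⟨ cong (d o p +_) a-p-b ⟩
    d o p + d a b           ≤⟨ op+ab≤oa+pb ⟩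
    d o a + d p b           ∎))
    where open ≤-Reasoning
  ... | inj₂ op+ab≤ob+pa = m≤n⇒m≤o⊔n (d o a) (+-cancelʳ-≤ (d p a) (d o p) (d o b) (begin
    d o p + d p a           ≡⟨ cong (d o p +_) (d-sym p a) ⟩
    d o p + d a p           ≤⟨ +-monoʳ-≤ (d o p) (m≤m+n (d a p) (d p b)) ⟩
    d o p + (d a p + d p b) ≡⟨ cong (d o p +_) a-p-b ⟩
    d o p + d a b           ≤⟨ op+ab≤ob+pa ⟩
    d o b + d p a           ∎))
    where open ≤-Reasoning

  median-gromov : ∀ {x a b p} → IsMedian x a b p → ⟨ a ∣ b ⟩[ x ] ≡ d x p + d x p
  median-gromov {x} {a} {b} {p} (median-of x-p-a x-p-b a-p-b) = +-cancelʳ-≡ (d a b) _ _ (begin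
    ⟨ a ∣ b ⟩[ x ] + d a b          ≡⟨ gromov-spec x a b ⟩
    d x a + d x b                   ≡⟨ cong₂ _+_ x-p-a x-p-b ⟨
    d x p + d p a + (d x p + d p b) ≡⟨ interchange (d x p) (d p a) (d x p) (d p b) ⟩
    d x p + d x p + (d p a + d p b) ≡⟨ cong (λ e → d x p + d x p + (e + d p b)) (d-sym p a) ⟩
    d x p + d x p + (d a p + d p b) ≡⟨ cong (d x p + d x p +_) a-p-b ⟩
    d x p + d x p + d a b           ∎)
    where open ≡-Reasoning

  module Branch (x a b : A) where

    -- In a tree: the geodesic from x to c passes through the projection of x onto [a, b].
    Beyond : A → Set
    Beyond c = ⟨ a ∣ b ⟩[ x ] ≤ ⟨ a ∣ c ⟩[ x ]

    beyond? : Decidable Beyond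
    beyond? c = _ ≤? _

    beyond-a : Beyond a
    beyond-a = gromov-≤ x (begin
      d x b + d a a ≡⟨ cong (d x b +_) (d-self a) ⟩
      d x b + 0     ≡⟨ +-identityʳ (d x b) ⟩
      d x b         ≤⟨ triangle x a b ⟩
      d x a + d a b ∎)
      where open ≤-Reasoning

    beyond-b : Beyond b
    beyond-b = ≤-refl

    beyond-self : Beyond x → ⟨ a ∣ b ⟩[ x ] ≡ 0
    beyond-self x-beyond = n≤0⇒n≡0 (≤-trans x-beyond (≤-reflexive (gromov-base x a)))

    beyond-pair : ∀ {u v} → Beyond u → Beyond v → ⟨ a ∣ b ⟩[ x ] ≤ ⟨ u ∣ v ⟩[ x ]
    beyond-pair {u} {v} u-beyond v-beyond with gromov-ultra x u v a
    ... | inj₁ ua≤uv = ≤-trans u-beyond (≤-trans (≤-reflexive (gromov-comm x a u)) ua≤uv)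
    ... | inj₂ av≤uv = ≤-trans v-beyond av≤uv

    beyond-boundary : ∀ {u y} → Beyond u → ¬ Beyond y → ⟨ y ∣ u ⟩[ x ] ≤ ⟨ y ∣ a ⟩[ x ]
    beyond-boundary {u} {y} u-beyond y-inside with gromov-ultra x y a u
    ... | inj₁ yu≤ya = yu≤ya
    ... | inj₂ ua≤ya = contradiction (begin
      ⟨ a ∣ b ⟩[ x ] ≤⟨ u-beyond ⟩
      ⟨ a ∣ u ⟩[ x ] ≡⟨ gromov-comm x a u ⟩
      ⟨ u ∣ a ⟩[ x ] ≤⟨ ua≤ya ⟩
      ⟨ y ∣ a ⟩[ x ] ≡⟨ gromov-comm x y a ⟩
      ⟨ a ∣ y ⟩[ x ] ∎) y-inside
      where open ≤-Reasoning

    -- In a tree, the geodesics from y to u and from z to v both pass through the projection of x.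
    inside-pair : ∀ {u v y z} → Beyond u → Beyond v → ¬ Beyond y → ¬ Beyond z → d y z ≤ d y u + d z v
    inside-pair {u} {v} {y} {z} u-beyond v-beyond y-inside z-inside =
      gromov-detour x (≤-trans through-a (+-monoʳ-≤ (⟨ y ∣ z ⟩[ x ]) (m∸n≤m (d x u + d x v) (d u v))))
      where
      inside<ab : ∀ {c} → ¬ Beyond c → ⟨ c ∣ a ⟩[ x ] < ⟨ a ∣ b ⟩[ x ]
      inside<ab {c} c-inside = subst (_< ⟨ a ∣ b ⟩[ x ]) (gromov-comm x a c) (≰⇒> c-inside)
      ab≤uv : ⟨ a ∣ b ⟩[ x ] ≤ ⟨ u ∣ v ⟩[ x ]
      ab≤uv = beyond-pair u-beyond v-beyond
      yu≤ya : ⟨ y ∣ u ⟩[ x ] ≤ ⟨ y ∣ a ⟩[ x ]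
      yu≤ya = beyond-boundary u-beyond y-inside
      zv≤za : ⟨ z ∣ v ⟩[ x ] ≤ ⟨ z ∣ a ⟩[ x ]
      zv≤za = beyond-boundary v-beyond z-inside
      through-a : ⟨ y ∣ u ⟩[ x ] + ⟨ z ∣ v ⟩[ x ] ≤ ⟨ y ∣ z ⟩[ x ] + ⟨ u ∣ v ⟩[ x ]
      through-a with gromov-ultra x y z a
      ... | inj₁ ya≤yz =
        +-mono-≤ (≤-trans yu≤ya ya≤yz) (≤-trans zv≤za (<⇒≤ (<-≤-trans (inside<ab z-inside) ab≤uv)))
      ... | inj₂ az≤yz = subst (⟨ y ∣ u ⟩[ x ] + ⟨ z ∣ v ⟩[ x ] ≤_)
                               (+-comm (⟨ u ∣ v ⟩[ x ]) (⟨ y ∣ z ⟩[ x ]))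
        (+-mono-≤ (≤-trans yu≤ya (<⇒≤ (<-≤-trans (inside<ab y-inside) ab≤uv)))
                  (≤-trans zv≤za (≤-trans (≤-reflexive (gromov-comm x z a)) az≤yz)))

  module Distorted (k r : ℕ) .{{_ : NonZero r}} (f : Fin (suc k) → A)
    (lower : ∀ i j → r * ∣ toℕ i - toℕ j ∣ ≤ d (f i) (f j))
    (upper : ∀ i j → 1000 * d (f i) (f j) ≤ 1001 * (r * ∣ toℕ i - toℕ j ∣)) where

    V : ℕ → A
    V n = f (clamp k n)

    BeyondFrom : ℕ → ℕ → Set
    BeyondFrom i n = Branch.Beyond (V i) (V 0) (V k) (V n)

    beyondFrom? : ∀ i → Decidable (BeyondFrom i)
    beyondFrom? i n = Branch.beyond? (V i) (V 0) (V k) (V n)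

    clamp-gap : ∀ m t → m + t ≤ k → ∣ toℕ (clamp k m) - toℕ (clamp k (m + t)) ∣ ≡ t
    clamp-gap m t m+t≤k =
      trans (cong₂ ∣_-_∣ (toℕ-clamp k (≤-trans (m≤m+n m t) m+t≤k)) (toℕ-clamp k m+t≤k)) (∣m-m+n∣≡n m t)

    lower-at : ∀ {m n} t → m + t ≡ n → n ≤ k → r * t ≤ d (V m) (V n)
    lower-at {m} t refl m+t≤k = subst (λ s → r * s ≤ d (V m) (V (m + t)))
      (clamp-gap m t m+t≤k) (lower (clamp k m) (clamp k (m + t)))

    upper-at : ∀ {m n} t → m + t ≡ n → n ≤ k → 1000 * d (V m) (V n) ≤ 1001 * (r * t)
    upper-at {m} t refl m+t≤k = subst (λ s → 1000 * d (V m) (V (m + t)) ≤ 1001 * (r * s))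
      (clamp-gap m t m+t≤k) (upper (clamp k m) (clamp k (m + t)))

    upper-step : ∀ n → suc n ≤ k → 1000 * d (V n) (V (suc n)) ≤ 1001 * r
    upper-step n n<k = subst (λ s → 1000 * d (V n) (V (suc n)) ≤ 1001 * s)
      (*-identityʳ r) (upper-at 1 (+-comm n 1) n<k)

    near-geodesic-from-exits : ∀ {m i M} → m < i → i ≤ M → M < k
      → BeyondFrom i m → ¬ BeyondFrom i (suc m) → ¬ BeyondFrom i M → BeyondFrom i (suc M)
      → 1000 * ⟨ V 0 ∣ V k ⟩[ V i ] ≤ 4 * r
    near-geodesic-from-exits {m} m<i i≤M M<k u-beyond y-inside z-inside v-beyond
      with m≤n⇒∃[o]m+o≡n m<i | m≤n⇒∃[o]m+o≡n i≤M
    ... | α , refl | β , refl = begin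
        1000 * ⟨ a ∣ b ⟩[ x ] ≤⟨ excess-bound r (suc α) (suc β) (⟨ a ∣ b ⟩[ x ]) (d u v) (d x u) (d x v)
                                              excess u⇝v xu≤ xv≤ ⟩
        r * (suc α + suc β)   ≤⟨ *-monoʳ-≤ r gap≤4 ⟩
        r * 4                 ≡⟨ *-comm r 4 ⟩
        4 * r                 ∎
      where
      open ≤-Reasoning
      open Branch (V (suc m + α)) (V 0) (V k)
      a = V 0
      b = V k
      u = V m
      y = V (suc m)
      x = V (suc m + α)
      z = V (suc m + α + β)
      v = V (suc (suc m + α + β))
      i≤k : suc m + α ≤ k
      i≤k = ≤-trans i≤M (<⇒≤ M<k)
      excess : ⟨ a ∣ b ⟩[ x ] + d u v ≤ d x u + d x v
      excess = ≤-trans (+-monoˡ-≤ (d u v) (beyond-pair u-beyond v-beyond)) (≤-reflexive (gromov-spec x u v))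
      xu≤ : 1000 * d x u ≤ 1001 * (r * suc α)
      xu≤ = subst (λ e → 1000 * e ≤ 1001 * (r * suc α)) (d-sym u x) (upper-at (suc α) (+-suc m α) i≤k)
      xv≤ : 1000 * d x v ≤ 1001 * (r * suc β)
      xv≤ = upper-at (suc β) (+-suc (suc m + α) β) M<k
      u⇝v : r * (suc α + suc β) ≤ d u v
      u⇝v = lower-at (suc α + suc β) (solve (m ∷ α ∷ β ∷ [])) M<k
      y⇝z : r * (α + β) ≤ d y u + d z v
      y⇝z = ≤-trans (lower-at (α + β) (sym (+-assoc (suc m) α β)) (<⇒≤ M<k))
                    (inside-pair u-beyond v-beyond y-inside z-inside)
      yu≤ : 1000 * d y u ≤ 1001 * r
      yu≤ = subst (λ e → 1000 * e ≤ 1001 * r) (d-sym u y) (upper-step m (≤-trans (m≤m+n (suc m) α) i≤k))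
      gap≤4 : suc α + suc β ≤ 4
      gap≤4 = subst (_≤ 4) (cong suc (sym (+-suc α β)))
        (s≤s (s≤s (short-gap r (α + β) (d y u) (d z v) y⇝z yu≤ (upper-step (suc m + α + β) M<k))))

    near-geodesicℕ : ∀ i → i ≤ k → 1000 * ⟨ V 0 ∣ V k ⟩[ V i ] ≤ 4 * r
    near-geodesicℕ i i≤k with beyondFrom? i i
    ... | yes x-beyond = subst (λ g → 1000 * g ≤ 4 * r) (sym (beyond-self x-beyond)) z≤n
      where open Branch (V i) (V 0) (V k)
    ... | no x-inside =
      let m , _ , m<i , u-beyond , y-inside = crossing (beyondFrom? i) z≤n beyond-a x-inside
          M , i≤M , M<k , z-inside , ¬v-inside = crossing (¬? ∘ beyondFrom? i) i≤k x-inside (_$ beyond-b)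
      in near-geodesic-from-exits m<i i≤M M<k u-beyond y-inside z-inside
           (decidable-stable (beyondFrom? i (suc M)) ¬v-inside)
      where open Branch (V i) (V 0) (V k)

    near-geodesic : ∀ i → 1000 * ⟨ f zero ∣ f (fromℕ k) ⟩[ f i ] ≤ 4 * r
    near-geodesic i = subst₂ (λ j l → 1000 * ⟨ f zero ∣ f l ⟩[ f j ] ≤ 4 * r) (clamp-toℕ k i) (clamp-fromℕ k)
                             (near-geodesicℕ (toℕ i) (toℕ≤pred[n] i))

-- The tree metric on binary strings

lcp : List Bool → List Bool → List Bool
lcp [] _ = []
lcp (_ ∷ _) [] = []
lcp (true ∷ u) (true ∷ v) = true ∷ lcp u v
lcp (false ∷ u) (false ∷ v) = false ∷ lcp u v
lcp (_ ∷ _) (_ ∷ _) = []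

ℓ : List Bool → List Bool → ℕ
ℓ u v = length (lcp u v)

δ : List Bool → List Bool → ℕ
δ [] v = length v
δ u [] = length u
δ (true ∷ u) (true ∷ v) = δ u v
δ (false ∷ u) (false ∷ v) = δ u v
δ u v = length u + length v

δ-sym : Symmetric δ
δ-sym [] [] = refl
δ-sym [] (_ ∷ _) = refl
δ-sym (_ ∷ _) [] = refl
δ-sym (true ∷ u) (true ∷ v) = δ-sym u v
δ-sym (false ∷ u) (false ∷ v) = δ-sym u v
δ-sym (true ∷ u) (false ∷ v) = +-comm (suc (length u)) (suc (length v))
δ-sym (false ∷ u) (true ∷ v) = +-comm (suc (length u)) (suc (length v))

δ-self : ∀ u → δ u u ≡ 0
δ-self [] = refl
δ-self (true ∷ u) = δ-self u
δ-self (false ∷ u) = δ-self u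

lcp-comm : ∀ u v → lcp u v ≡ lcp v u
lcp-comm [] [] = refl
lcp-comm [] (_ ∷ _) = refl
lcp-comm (_ ∷ _) [] = refl
lcp-comm (true ∷ u) (true ∷ v) = cong (true ∷_) (lcp-comm u v)
lcp-comm (false ∷ u) (false ∷ v) = cong (false ∷_) (lcp-comm u v)
lcp-comm (true ∷ u) (false ∷ v) = refl
lcp-comm (false ∷ u) (true ∷ v) = refl

suc-both : ∀ {a l m n} → a + (l + l) ≡ m + n → a + (suc l + suc l) ≡ suc m + suc n
suc-both {a} {l} {m} {n} e = begin
  a + (suc l + suc l)     ≡⟨ solve (a ∷ l ∷ []) ⟩
  suc (suc (a + (l + l))) ≡⟨ cong (λ t → suc (suc t)) e ⟩
  suc (suc (m + n))       ≡⟨ cong suc (+-suc m n) ⟨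
  suc m + suc n           ∎
  where open ≡-Reasoning

δ+2ℓ : ∀ u v → δ u v + (ℓ u v + ℓ u v) ≡ length u + length v
δ+2ℓ [] v = +-identityʳ (length v)
δ+2ℓ (_ ∷ _) [] = refl
δ+2ℓ (true ∷ u) (true ∷ v) = suc-both (δ+2ℓ u v)
δ+2ℓ (false ∷ u) (false ∷ v) = suc-both (δ+2ℓ u v)
δ+2ℓ (true ∷ u) (false ∷ v) = +-identityʳ _
δ+2ℓ (false ∷ u) (true ∷ v) = +-identityʳ _

ℓ-ultra : ∀ u v w → ℓ u v ≤ ℓ u w ⊎ ℓ v w ≤ ℓ u w
ℓ-ultra [] v w = inj₁ z≤n
ℓ-ultra (_ ∷ _) [] w = inj₁ z≤n
ℓ-ultra (_ ∷ _) (_ ∷ _) [] = inj₂ z≤n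
ℓ-ultra (true ∷ u) (true ∷ v) (true ∷ w) = Sum.map s≤s s≤s (ℓ-ultra u v w)
ℓ-ultra (false ∷ u) (false ∷ v) (false ∷ w) = Sum.map s≤s s≤s (ℓ-ultra u v w)
ℓ-ultra (true ∷ u) (true ∷ v) (false ∷ w) = inj₂ z≤n
ℓ-ultra (false ∷ u) (false ∷ v) (true ∷ w) = inj₂ z≤n
ℓ-ultra (true ∷ u) (false ∷ v) w = inj₁ z≤n
ℓ-ultra (false ∷ u) (true ∷ v) w = inj₁ z≤n

δ-four-point : FourPointCondition δ
δ-four-point = four-point-from-root δ length ℓ δ+2ℓ (λ u v → cong length (lcp-comm u v)) ℓ-ultra

open ZeroHyperbolic δ δ-sym δ-self δ-four-point

lcp-between-rootˡ : ∀ u v → Between [] u (lcp u v)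
lcp-between-rootˡ [] v = refl
lcp-between-rootˡ (_ ∷ _) [] = refl
lcp-between-rootˡ (true ∷ u) (true ∷ v) = cong suc (lcp-between-rootˡ u v)
lcp-between-rootˡ (false ∷ u) (false ∷ v) = cong suc (lcp-between-rootˡ u v)
lcp-between-rootˡ (true ∷ u) (false ∷ v) = refl
lcp-between-rootˡ (false ∷ u) (true ∷ v) = refl

lcp-between-rootʳ : ∀ u v → Between [] v (lcp u v)
lcp-between-rootʳ u v = subst (Between [] v) (lcp-comm v u) (lcp-between-rootˡ v u)

lcp-between : ∀ u v → Between u v (lcp u v)
lcp-between [] v = refl
lcp-between (_ ∷ u) [] = +-identityʳ (suc (length u))
lcp-between (true ∷ u) (true ∷ v) = lcp-between u v
lcp-between (false ∷ u) (false ∷ v) = lcp-between u v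
lcp-between (true ∷ u) (false ∷ v) = refl
lcp-between (false ∷ u) (true ∷ v) = refl

median-root : ∀ v w → IsMedian [] v w (lcp v w)
median-root v w = median-of (lcp-between-rootˡ v w) (lcp-between-rootʳ v w) (lcp-between v w)

fork-length : ∀ u p (w : List Bool) → length p + δ p u ≡ length u
            → δ u p + (suc (length p) + suc (length w)) ≡ suc (length u) + suc (length w)
fork-length u p w root-p-u = begin
  δ u p + (suc (length p) + suc (length w)) ≡⟨ cong (_+ (suc (length p) + suc (length w))) (δ-sym u p) ⟩
  δ p u + (suc (length p) + suc (length w)) ≡⟨ x∙yz≈yx∙z (δ p u) (suc (length p)) (suc (length w)) ⟩
  suc (length p) + δ p u + suc (length w)   ≡⟨ cong (λ t → suc t + suc (length w)) root-p-u ⟩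
  suc (length u) + suc (length w)           ∎
  where open ≡-Reasoning

fork-between : ∀ c u p w → Between [] u p → Between (c ∷ u) (not c ∷ w) (c ∷ p)
fork-between true = fork-length
fork-between false = fork-length

median-fork : ∀ c u v w → IsMedian (c ∷ u) (c ∷ v) (not c ∷ w) (c ∷ lcp u v)
median-fork true u v w =
  median-of (lcp-between u v) (fork-between true u _ w (lcp-between-rootˡ u v))
            (fork-between true v _ w (lcp-between-rootʳ u v))
median-fork false u v w =
  median-of (lcp-between u v) (fork-between false u _ w (lcp-between-rootˡ u v))
            (fork-between false v _ w (lcp-between-rootʳ u v))

median-cons : ∀ c {u v w m} → IsMedian u v w m → IsMedian (c ∷ u) (c ∷ v) (c ∷ w) (c ∷ m)
median-cons true (median-of u-m-v u-m-w v-m-w) = median-of u-m-v u-m-w v-m-w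
median-cons false (median-of u-m-v u-m-w v-m-w) = median-of u-m-v u-m-w v-m-w

-- The deepest of the three pairwise longest common prefixes.
median : List Bool → List Bool → List Bool → List Bool
median [] v w = lcp v w
median u [] w = lcp u w
median u v [] = lcp u v
median (true ∷ u) (true ∷ v) (true ∷ w) = true ∷ median u v w
median (false ∷ u) (false ∷ v) (false ∷ w) = false ∷ median u v w
median (true ∷ u) (true ∷ v) (false ∷ w) = true ∷ lcp u v
median (false ∷ u) (false ∷ v) (true ∷ w) = false ∷ lcp u v
median (true ∷ u) (false ∷ v) (true ∷ w) = true ∷ lcp u w
median (false ∷ u) (true ∷ v) (false ∷ w) = false ∷ lcp u w
median (false ∷ u) (true ∷ v) (true ∷ w) = true ∷ lcp v w
median (true ∷ u) (false ∷ v) (false ∷ w) = false ∷ lcp v w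

median-spec : ∀ u v w → IsMedian u v w (median u v w)
median-spec [] v w = median-root v w
median-spec (c ∷ u) [] w = median-swap₁₂ (median-root (c ∷ u) w)
median-spec (c ∷ u) (c′ ∷ v) [] = median-swap₂₃ (median-swap₁₂ (median-root (c ∷ u) (c′ ∷ v)))
median-spec (true ∷ u) (true ∷ v) (true ∷ w) = median-cons true (median-spec u v w)
median-spec (false ∷ u) (false ∷ v) (false ∷ w) = median-cons false (median-spec u v w)
median-spec (true ∷ u) (true ∷ v) (false ∷ w) = median-fork true u v w
median-spec (false ∷ u) (false ∷ v) (true ∷ w) = median-fork false u v w
median-spec (true ∷ u) (false ∷ v) (true ∷ w) = median-swap₂₃ (median-fork true u w v)
median-spec (false ∷ u) (true ∷ v) (false ∷ w) = median-swap₂₃ (median-fork false u w v)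
median-spec (false ∷ u) (true ∷ v) (true ∷ w) = median-swap₁₂ (median-swap₂₃ (median-fork true v w u))
median-spec (true ∷ u) (false ∷ v) (false ∷ w) = median-swap₁₂ (median-swap₂₃ (median-fork false v w u))

-- Walks and geodesics in Tree(N)

Adjacent : List Bool → List Bool → Set
Adjacent u w = (∃ λ b → w ≡ u ++ b ∷ []) ⊎ (∃ λ b → u ≡ w ++ b ∷ [])

δ-child : ∀ u b → δ u (u ++ b ∷ []) ≡ 1
δ-child [] b = refl
δ-child (true ∷ u) b = δ-child u b
δ-child (false ∷ u) b = δ-child u b

δ-adjacent : ∀ {u w} → Adjacent u w → δ u w ≤ 1
δ-adjacent {u} (inj₁ (b , refl)) = ≤-reflexive (δ-child u b)
δ-adjacent {w = w} (inj₂ (b , refl)) = ≤-reflexive (trans (δ-sym (w ++ b ∷ []) w) (δ-child w b))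

adjacent-cons : ∀ c {u w} → Adjacent u w → Adjacent (c ∷ u) (c ∷ w)
adjacent-cons c = Sum.map (Product.map₂ (cong (c ∷_))) (Product.map₂ (cong (c ∷_)))

-- Walks in Tree(K) with vertices as bare strings, so that prefixing a letter needs no transport
-- of length proofs.
data StringWalk (K : ℕ) : List Bool → List Bool → ℕ → Set where
  done : ∀ {u} → StringWalk K u u 0
  edge : ∀ {u w v n} → length u < K → length w < K → Adjacent u w → StringWalk K w v n
       → StringWalk K u v (suc n)

to-walk : ∀ {N u v n} (u<N : length u < N) (v<N : length v < N) → StringWalk N u v n
        → Walk (u , u<N) (v , v<N) n
to-walk {u = u} u<N v<N done = subst (λ q → Walk (u , u<N) (u , q) 0) (<-irrelevant u<N v<N) here
to-walk u<N v<N (edge _ w<N a p) = step a (to-walk w<N v<N p)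

widen : ∀ {K K′ u v n} → K ≤ K′ → StringWalk K u v n → StringWalk K′ u v n
widen K≤K′ done = done
widen K≤K′ (edge u<K w<K a p) = edge (≤-trans u<K K≤K′) (≤-trans w<K K≤K′) a (widen K≤K′ p)

cons-walk : ∀ c {K u v n} → StringWalk K u v n → StringWalk (suc K) (c ∷ u) (c ∷ v) n
cons-walk c done = done
cons-walk c (edge u<K w<K a p) = edge (s≤s u<K) (s≤s w<K) (adjacent-cons c a) (cons-walk c p)

_++ʷ_ : ∀ {K u w v n m} → StringWalk K u w n → StringWalk K w v m → StringWalk K u v (n + m)
done ++ʷ q = q
edge u<K w<K a p ++ʷ q = edge u<K w<K a (p ++ʷ q)

reverse-onto : ∀ {K u v w n m} → StringWalk K u v n → StringWalk K u w m → StringWalk K v w (n + m)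
reverse-onto done q = q
reverse-onto {K} {v = v} {w} {suc n} {m} (edge u<K w<K a p) q =
  subst (StringWalk K v w) (+-suc n m) (reverse-onto p (edge w<K u<K (swap a) q))

reverse : ∀ {K u v n} → StringWalk K u v n → StringWalk K v u n
reverse {K} {u} {v} {n} p = subst (StringWalk K v u) (+-identityʳ n) (reverse-onto p done)

descent : ∀ v → StringWalk (suc (length v)) [] v (length v)
descent [] = done
descent (c ∷ v) = edge (s≤s z≤n) (s≤s (s≤s z≤n)) (inj₁ (c , refl)) (cons-walk c (descent v))

through-root : ∀ u v → StringWalk (suc (length u ⊔ length v)) u v (length u + length v)
through-root u v = widen (s≤s (m≤m⊔n (length u) (length v))) (reverse (descent u))
                ++ʷ widen (s≤s (m≤n⊔m (length u) (length v))) (descent v)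

geodesic : ∀ u v → StringWalk (suc (length u ⊔ length v)) u v (δ u v)
geodesic [] v = descent v
geodesic (c ∷ u) [] = reverse (descent (c ∷ u))
geodesic (true ∷ u) (true ∷ v) = cons-walk true (geodesic u v)
geodesic (false ∷ u) (false ∷ v) = cons-walk false (geodesic u v)
geodesic (true ∷ u) (false ∷ v) = through-root (true ∷ u) (false ∷ v)
geodesic (false ∷ u) (true ∷ v) = through-root (false ∷ u) (true ∷ v)

geodesic-walk : ∀ {N} (u v : Vertex N) → Walk u v (δ (proj₁ u) (proj₁ v))
geodesic-walk (u , u<N) (v , v<N) = to-walk u<N v<N (widen (⊔-lub u<N v<N) (geodesic u v))

δ≤walk : ∀ {N} {u v : Vertex N} {m} → Walk u v m → δ (proj₁ u) (proj₁ v) ≤ m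
δ≤walk {u = u , _} here = ≤-reflexive (δ-self u)
δ≤walk {u = u , _} {v , _} (step {w = w , _} a p) =
  ≤-trans (triangle u w v) (+-mono-≤ (δ-adjacent a) (δ≤walk p))

tree-dist : ∀ {N} (u v : Vertex N) → Dist u v (δ (proj₁ u) (proj₁ v))
tree-dist u v = geodesic-walk u v , δ≤walk

_++W_ : ∀ {N} {u w v : Vertex N} {n m} → Walk u w n → Walk w v m → Walk u v (n + m)
here ++W q = q
step a p ++W q = step a (p ++W q)

on-junction : ∀ {N} {u w v : Vertex N} {n m} (p : Walk u w n) (q : Walk w v m) → OnWalk w (p ++W q)
on-junction here q = start refl
on-junction (step a p) q = later (on-junction p q)

on-geodesic : ∀ {N} (a b p : Vertex N) → Between (proj₁ a) (proj₁ b) (proj₁ p) → OnGeodesic a b p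
on-geodesic a b p a-p-b =
  _ , geodesic-walk a p ++W geodesic-walk p b , (λ q → subst (_≤ _) (sym a-p-b) (δ≤walk q)) ,
  on-junction (geodesic-walk a p) (geodesic-walk p b)

mainTheorem15 : (k' N r : ℕ) → (f : Fin (suc k') → Vertex N)
    → 1 ≤ r → r ≤ N
    → (∀ i j d → Dist (f i) (f j) d
         → (r * ∣ toℕ i - toℕ j ∣ ≤ d) × (1000 * d ≤ 1001 * (r * ∣ toℕ i - toℕ j ∣)))
    → ∀ i → Σ (Vertex N) λ w → Σ ℕ λ d
         → OnGeodesic (f Fin.zero) (f (fromℕ k')) w × Dist (f i) w d × (100 * d ≤ r)
mainTheorem15 k' N r f r≥1 _ H i =
  p̂ , δ x p , on-geodesic (f zero) (f (fromℕ k')) p̂ a-p-b , tree-dist (f i) p̂ , x-near-p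
  where
  x = proj₁ (f i)
  a = proj₁ (f zero)
  b = proj₁ (f (fromℕ k'))
  p = median x a b
  p-median : IsMedian x a b p
  p-median = median-spec x a b
  a-p-b : Between a b p
  a-p-b = IsMedian.a-p-b p-median
  p̂ : Vertex N
  p̂ = p , ≤-trans (s≤s (between-≤ [] {a} {b} {p} a-p-b)) (⊔-lub (proj₂ (f zero)) (proj₂ (f (fromℕ k'))))
  lower : ∀ j l → r * ∣ toℕ j - toℕ l ∣ ≤ δ (proj₁ (f j)) (proj₁ (f l))
  lower j l = proj₁ (H j l _ (tree-dist (f j) (f l)))
  upper : ∀ j l → 1000 * δ (proj₁ (f j)) (proj₁ (f l)) ≤ 1001 * (r * ∣ toℕ j - toℕ l ∣)
  upper j l = proj₂ (H j l _ (tree-dist (f j) (f l)))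
  open Distorted k' r {{>-nonZero r≥1}} (proj₁ ∘ f) lower upper
  x-near-p : 100 * δ x p ≤ r
  x-near-p = loosen-bound (δ x p) r
    (subst (λ g → 1000 * g ≤ 4 * r) (median-gromov p-median) (near-geodesic i))
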